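{- Let $F(\mathbf{z})=1-\sum_{i=1}^n z_i^2+$ (higher-order terms) be a formal power series and $\mathbf{V}=(V_1,\ldots,V_n)$ formal power series with $V_i(\mathbf{z})=z_i+$ (higher-order terms). Let $\{P_{\vec{u}}\}$ be the free Sheffer polynomials defined by \[ H(\mathbf{x},\mathbf{z}) := 1+\sum_{\vec{u}\neq\emptyset} P_{\vec{u}}(\mathbf{x}) z_{\vec{u}} = F(\mathbf{z})\bigl(1-\mathbf{x}\cdot\mathbf{V}(\mathbf{z})\bigr)^{ -1}. \] Define the linear functional $\varphi$ on $\mathbb{R}\langle x_1,\ldots,x_n\rangle$ by $\varphi[1]=1$ and $\varphi[P_{\vec{u}}]=0$ for $|\vec{u}|\ge 1$. Then \[ H(\mathbf{x},\mathbf{z}) = \bigl(1-\mathbf{x}\cdot\mathbf{U}(\mathbf{z}) + R(\mathbf{U}(\mathbf{z}))\bigr)^{ -1}, \] where $R$ is the free cumulant generating function of $\varphi$ and $U_i(\mathbf{z})=V_i(\mathbf{z})F(\mathbf{z})^{ -1}$.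
   Context: $x_1,\ldots,x_n$ and $z_1,\ldots,z_n$ are non-commuting indeterminates, each $x_i$ commuting with each $z_j$; power series in $\mathbf{z}$ are formal non-commutative power series, $F^{ -1}$ denotes the multiplicative inverse, and $\mathbf{x}\cdot\mathbf{V}=\sum_i x_iV_i$. For a multi-index $\vec{u}=(u(1),\ldots,u(k))$, $z_{\vec{u}}=z_{u(1)}\cdots z_{u(k)}$, $x_{\vec{u}}=x_{u(1)}\cdots x_{u(k)}$; $P_{\vec{u}}$ is the coefficient of $z_{\vec{u}}$ (it is a monic polynomial). For a unital linear functional $\varphi$ on $\mathbb{R}\langle \mathbf{x}\rangle$, its moment generating function is $M(\mathbf{z})=\sum_{|\vec{u}|\ge1}\varphi[x_{\vec{u}}]z_{\vec{u}}$, and its free cumulant generating function $R(\mathbf{z})=\sum_{|\vec{u}|\ge1}R[x_{\vec{u}}]z_{\vec{u}}$ is the unique power series satisfying $R\bigl(w_1(1+M(\mathbf{w})),\ldots,w_n(1+M(\mathbf{w}))\bigr)=M(\mathbf{w})$, where substituting series into $R$ means replacing each $z_i$ in each monomial by the indicated series and multiplying in order. -}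

module Defs where

open import Algebra.Bundles using (CommutativeRing)
open import Data.Nat using (ℕ; zero; suc) renaming (_+_ to _+ℕ_)
open import Data.Fin using (Fin; _≟_)
open import Data.List using (List; []; _∷_; map; concatMap; foldr; length; upTo; allFin)
open import Data.Product using (_×_; _,_; proj₁; proj₂)
open import Relation.Nullary using (yes; no)

-- Formal series over a commutative coefficient ring K, in n non-commuting
-- variables x₁..xₙ and n non-commuting variables z₁..zₙ, each xᵢ commuting
-- with each zⱼ.  A monomial is x_w z_v (w, v words), so a series is a
-- coefficient function on pairs of words.
module Series {c ℓ} (Rg : CommutativeRing c ℓ) (n : ℕ) where
  open CommutativeRing Rg renaming (Carrier to K)

  Word : Set
  Word = List (Fin n)

  ZSer : Set c
  ZSer = Word → K

  -- series in x and z: coefficient of x_w z_v  (first argument w, second v)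
  Ser : Set c
  Ser = Word → Word → K

  Σl : List K → K
  Σl = foldr _+_ 0#

  splits : Word → List (Word × Word)
  splits [] = ([] , []) ∷ []
  splits (a ∷ w) = ([] , a ∷ w) ∷ map (λ p → (a ∷ proj₁ p , proj₂ p)) (splits w)

  words : ℕ → List Word
  words zero = [] ∷ []
  words (suc k) = concatMap (λ i → map (i ∷_) (words k)) (allFin n)

  wordsUpTo : ℕ → List Word
  wordsUpTo N = concatMap words (upTo (suc N))

  δ : Fin n → Fin n → K
  δ i j with i ≟ j
  ... | yes _ = 1#
  ... | no _ = 0#

  one : Ser
  one [] [] = 1#
  one [] (_ ∷ _) = 0#
  one (_ ∷ _) _ = 0#

  infixl 6 _⊕_ _⊖_
  infixl 7 _⊛_

  _⊕_ : Ser → Ser → Ser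
  (A ⊕ B) w v = A w v + B w v

  _⊖_ : Ser → Ser → Ser
  (A ⊖ B) w v = A w v - B w v

  -- Cauchy product (x and z commute, so the x-word and z-word split independently)
  _⊛_ : Ser → Ser → Ser
  (A ⊛ B) w v = Σl (concatMap (λ p → map (λ q → A (proj₁ p) (proj₁ q) * B (proj₂ p) (proj₂ q))
                                          (splits v)) (splits w))

  pow : Ser → ℕ → Ser
  pow A zero = one
  pow A (suc k) = A ⊛ pow A k

  -- multiplicative inverse of a series with constant term 1:
  -- A⁻¹ = Σₖ (1 - A)ᵏ; since 1 - A has no constant term, only k ≤ |w|+|v|
  -- contribute to the coefficient of x_w z_v, so this truncation is exact.
  inv : Ser → Ser
  inv A w v = Σl (map (λ k → pow (one ⊖ A) k w v) (upTo (suc (length w +ℕ length v))))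

  emb : ZSer → Ser
  emb f [] v = f v
  emb f (_ ∷ _) v = 0#

  zvar : Fin n → Ser
  zvar i [] (j ∷ []) = δ i j
  zvar i [] [] = 0#
  zvar i [] (_ ∷ _ ∷ _) = 0#
  zvar i (_ ∷ _) _ = 0#

  xdot : (Fin n → Ser) → Ser
  xdot U [] v = 0#
  xdot U (i ∷ w) v = U i w v

  prodS : (Fin n → Ser) → Word → Ser
  prodS S [] = one
  prodS S (i ∷ u) = S i ⊛ prodS S u

  -- substitution G(S₁,…,Sₙ) = Σ_u G[u] S_{u(1)}⋯S_{u(k)}, for series Sᵢ without
  -- constant term (then only |u| ≤ |w|+|v| contribute to x_w z_v, so it is exact)
  subst : ZSer → (Fin n → Ser) → Ser
  subst G S w v = Σl (map (λ u → G u * prodS S u w v) (wordsUpTo (length w +ℕ length v)))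

  -- moment generating function M(z) = Σ_{|u|≥1} φ[x_u] z_u from moments m u = φ[x_u]
  mgf : (Word → K) → ZSer
  mgf m [] = 0#
  mgf m (i ∷ u) = m (i ∷ u)

  infix 4 _≋_
  _≋_ : Ser → Ser → Set ℓ
  A ≋ B = ∀ w v → A w v ≈ B w v

-- Expanding (1 - x·V)⁻¹ = Σ_w x_w V_{w(1)}⋯V_{w(k)} shows that φ[P_u] is the coefficient of z_u
-- in F · Σ_w φ[x_w] V_w = F · (1 + M(V)), so the defining property of φ says exactly that
-- F⁻¹ = 1 + M(V). Then Uᵢ = Vᵢ (1 + M(V)) is zᵢ (1 + M(z)) with V substituted for z, and since
-- substitution is multiplicative and composes, the functional equation of R gives
-- R(U) = M(V) = F⁻¹ - 1. Hence 1 - x·U + R(U) = F⁻¹ - x·V F⁻¹ = (1 - x·V) F⁻¹, whose inverse is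
-- F (1 - x·V)⁻¹ = H.

{-# OPTIONS --safe #-}
module Submission where

open import Defs
open import Algebra.Bundles using (CommutativeRing)
open import Data.Nat using (ℕ; zero; suc; _<_; _≤_; s≤s; z≤n; _≤′_; ≤′-refl; ≤′-step)
  renaming (_+_ to _+ℕ_)
open import Data.Nat.Properties
  using (≤-refl; ≤-pred; ≤⇒≤′; ≤′⇒≤; +-mono-≤; +-mono-<-≤; +-mono-≤-<; ≤-<-trans; <-≤-trans)
open import Data.Fin using (Fin; _≟_) renaming (zero to fzero; suc to fsuc)
open import Data.Fin.Properties using (suc-injective)
open import Data.List using (List; []; _∷_; map; length; _++_; concatMap; applyUpTo; upTo; allFin)
import Data.List.Properties as List
open import Data.Maybe using (nothing)
open import Data.Product using (_×_; _,_; proj₁; proj₂)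
open import Function using (_∘_)
open import Level using (Level)
open import Relation.Binary.Bundles using (Setoid)
open import Relation.Binary.PropositionalEquality as ≡ using (_≡_; _≢_)
import Relation.Binary.Reasoning.Setoid as SetoidReasoning
open import Relation.Nullary using (yes; no; contradiction)
open import Tactic.RingSolver.Core.AlmostCommutativeRing using (fromCommutativeRing)
import Tactic.RingSolver.NonReflective as NonReflectiveSolver

module SeriesProperties {c ℓ} (Rg : CommutativeRing c ℓ) (n : ℕ) where
  open CommutativeRing Rg renaming (Carrier to K)
  open Series Rg n
  open import Algebra.Properties.Ring ring using (-0#≈0#; [y-z]x≈yx-zx; ⁻¹-anti-homo‿-)
  open NonReflectiveSolver (fromCommutativeRing Rg (λ _ → nothing))
    using (solve; _⊜_) renaming (_⊕_ to _:+_; ⊝_ to :-_)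

  module ≈-Reasoning = SetoidReasoning setoid

  private variable
    ι ι′ : Level
    I : Set ι
    J : Set ι′

  x+y-y≈x : ∀ x y → (x + y) - y ≈ x
  x+y-y≈x x y = trans (+-assoc x y (- y)) (trans (+-congˡ (-‿inverseʳ y)) (+-identityʳ x))

  -- Finite sums

  sumL : List I → (I → K) → K
  sumL xs f = Σl (map f xs)

  syntax sumL xs (λ x → e) = ∑[ x ∈ xs ] e

  ∑-cong : (xs : List I) {f g : I → K} → (∀ x → f x ≈ g x) → sumL xs f ≈ sumL xs g
  ∑-cong []       f≈g = refl
  ∑-cong (x ∷ xs) f≈g = +-cong (f≈g x) (∑-cong xs f≈g)

  ∑-zero : (xs : List I) {f : I → K} → (∀ x → f x ≈ 0#) → sumL xs f ≈ 0#
  ∑-zero []       f≈0 = refl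
  ∑-zero (x ∷ xs) f≈0 = trans (+-cong (f≈0 x) (∑-zero xs f≈0)) (+-identityˡ 0#)

  ∑-distrib-+ : (xs : List I) (f g : I → K) → ∑[ x ∈ xs ] (f x + g x) ≈ sumL xs f + sumL xs g
  ∑-distrib-+ []       f g = sym (+-identityˡ 0#)
  ∑-distrib-+ (x ∷ xs) f g = trans (+-congˡ (∑-distrib-+ xs f g)) (interchange _ _ _ _)
    where
    interchange : ∀ a b c d → (a + b) + (c + d) ≈ (a + c) + (b + d)
    interchange = solve 4 (λ a b c d → ((a :+ b) :+ (c :+ d)) ⊜ ((a :+ c) :+ (b :+ d))) refl

  -‿distrib-∑ : (xs : List I) (f : I → K) → - sumL xs f ≈ ∑[ x ∈ xs ] (- f x)
  -‿distrib-∑ []       f = -0#≈0#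
  -‿distrib-∑ (x ∷ xs) f = trans (-‿+ _ _) (+-congˡ (-‿distrib-∑ xs f))
    where
    -‿+ : ∀ a b → - (a + b) ≈ - a + - b
    -‿+ = solve 2 (λ a b → (:- (a :+ b)) ⊜ (:- a :+ :- b)) refl

  ∑-distrib-- : (xs : List I) (f g : I → K) → ∑[ x ∈ xs ] (f x - g x) ≈ sumL xs f - sumL xs g
  ∑-distrib-- xs f g = trans (∑-distrib-+ xs f (λ x → - g x)) (+-congˡ (sym (-‿distrib-∑ xs g)))

  *-distribˡ-∑ : (k : K) (xs : List I) (f : I → K) → k * sumL xs f ≈ ∑[ x ∈ xs ] (k * f x)
  *-distribˡ-∑ k []       f = zeroʳ k
  *-distribˡ-∑ k (x ∷ xs) f = trans (distribˡ k _ _) (+-congˡ (*-distribˡ-∑ k xs f))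

  *-distribʳ-∑ : (k : K) (xs : List I) (f : I → K) → sumL xs f * k ≈ ∑[ x ∈ xs ] (f x * k)
  *-distribʳ-∑ k []       f = zeroˡ k
  *-distribʳ-∑ k (x ∷ xs) f = trans (distribʳ k _ _) (+-congˡ (*-distribʳ-∑ k xs f))

  ∑-comm : (xs : List I) (ys : List J) (f : I → J → K) →
           ∑[ x ∈ xs ] sumL ys (f x) ≈ ∑[ y ∈ ys ] ∑[ x ∈ xs ] f x y
  ∑-comm []       ys f = sym (∑-zero ys (λ _ → refl))
  ∑-comm (x ∷ xs) ys f = trans (+-congˡ (∑-comm xs ys f)) (sym (∑-distrib-+ ys (f x) _))

  ∑-map : (g : J → I) (xs : List J) (f : I → K) → sumL (map g xs) f ≈ sumL xs (f ∘ g)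
  ∑-map g []       f = refl
  ∑-map g (x ∷ xs) f = +-congˡ (∑-map g xs f)

  Σl-++ : (xs ys : List K) → Σl (xs ++ ys) ≈ Σl xs + Σl ys
  Σl-++ []       ys = sym (+-identityˡ _)
  Σl-++ (x ∷ xs) ys = trans (+-congˡ (Σl-++ xs ys)) (sym (+-assoc _ _ _))

  Σl-concatMap : (h : I → List K) (xs : List I) → Σl (concatMap h xs) ≈ ∑[ x ∈ xs ] Σl (h x)
  Σl-concatMap h []       = refl
  Σl-concatMap h (x ∷ xs) = trans (Σl-++ (h x) (concatMap h xs)) (+-congˡ (Σl-concatMap h xs))

  ∑-concatMap : (g : J → List I) (xs : List J) (f : I → K) →
                sumL (concatMap g xs) f ≈ ∑[ x ∈ xs ] sumL (g x) f
  ∑-concatMap g xs f = trans (reflexive (≡.cong Σl (List.map-concatMap f g xs))) (Σl-concatMap (map f ∘ g) xs)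

  ∑-applyUpTo-suc : (g : ℕ → I) (M : ℕ) (f : I → K) →
                    sumL (applyUpTo g (suc M)) f ≈ sumL (applyUpTo g M) f + f (g M)
  ∑-applyUpTo-suc g zero    f = trans (+-identityʳ _) (sym (+-identityˡ _))
  ∑-applyUpTo-suc g (suc M) f = trans (+-congˡ (∑-applyUpTo-suc (g ∘ suc) M f)) (sym (+-assoc _ _ _))

  ∑-upTo-suc : (M : ℕ) (f : ℕ → K) → sumL (upTo (suc M)) f ≈ f 0 + sumL (upTo M) (f ∘ suc)
  ∑-upTo-suc M f = +-congˡ (reflexive (≡.cong Σl (≡.trans (List.map-applyUpTo suc f M)
                                                   (≡.sym (List.map-applyUpTo (λ k → k) (f ∘ suc) M)))))

  ∑-words-suc : ∀ k (f : Word → K) →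
                sumL (words (suc k)) f ≈ ∑[ i ∈ allFin n ] ∑[ u ∈ words k ] f (i ∷ u)
  ∑-words-suc k f = trans (∑-concatMap (λ i → map (i ∷_) (words k)) (allFin n) f)
                          (∑-cong (allFin n) (λ i → ∑-map (i ∷_) (words k) f))

  ∑-words-zero : ∀ k {f : Word → K} → (∀ u → length u ≡ k → f u ≈ 0#) → sumL (words k) f ≈ 0#
  ∑-words-zero zero    f≈0 = trans (+-identityʳ _) (f≈0 [] ≡.refl)
  ∑-words-zero (suc k) f≈0 = trans (∑-words-suc k _)
    (∑-zero (allFin n) (λ i → ∑-words-zero k (λ u |u|≡k → f≈0 (i ∷ u) (≡.cong suc |u|≡k))))

  ∑-wordsUpTo-suc : ∀ N (f : Word → K) →
    sumL (wordsUpTo (suc N)) f ≈ f [] + ∑[ i ∈ allFin n ] ∑[ u ∈ wordsUpTo N ] f (i ∷ u)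
  ∑-wordsUpTo-suc N f = begin
    sumL (wordsUpTo (suc N)) f
      ≈⟨ ∑-concatMap words (upTo (suc (suc N))) f ⟩
    ∑[ k ∈ upTo (suc (suc N)) ] sumL (words k) f
      ≈⟨ ∑-upTo-suc (suc N) (λ k → sumL (words k) f) ⟩
    (f [] + 0#) + ∑[ k ∈ upTo (suc N) ] sumL (words (suc k)) f
      ≈⟨ +-cong (+-identityʳ _) (∑-cong (upTo (suc N)) (λ k → ∑-words-suc k f)) ⟩
    f [] + ∑[ k ∈ upTo (suc N) ] ∑[ i ∈ allFin n ] ∑[ u ∈ words k ] f (i ∷ u)
      ≈⟨ +-congˡ (∑-comm (upTo (suc N)) (allFin n) _) ⟩
    f [] + ∑[ i ∈ allFin n ] ∑[ k ∈ upTo (suc N) ] ∑[ u ∈ words k ] f (i ∷ u)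
      ≈⟨ +-congˡ (∑-cong (allFin n) (λ i → ∑-concatMap words (upTo (suc N)) _)) ⟨
    f [] + ∑[ i ∈ allFin n ] ∑[ u ∈ wordsUpTo N ] f (i ∷ u) ∎
    where open ≈-Reasoning

  ∑-wordsUpTo-sucʳ : ∀ N (f : Word → K) →
    sumL (wordsUpTo (suc N)) f ≈ sumL (wordsUpTo N) f + sumL (words (suc N)) f
  ∑-wordsUpTo-sucʳ N f = trans (∑-concatMap words (upTo (suc (suc N))) f)
    (trans (∑-applyUpTo-suc (λ k → k) (suc N) (λ k → sumL (words k) f))
           (+-congʳ (sym (∑-concatMap words (upTo (suc N)) f))))

  ∑-allFin-suc : ∀ {k} (f : Fin (suc k) → K) →
                 sumL (allFin (suc k)) f ≈ f fzero + sumL (allFin k) (f ∘ fsuc)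
  ∑-allFin-suc f = +-congˡ (reflexive (≡.cong Σl
    (≡.trans (List.map-tabulate fsuc f) (≡.sym (List.map-tabulate (λ j → j) (f ∘ fsuc))))))

  ∑-allFin-select : ∀ {k} (i : Fin k) (f : Fin k → K) →
                    (∀ j → i ≢ j → f j ≈ 0#) → sumL (allFin k) f ≈ f i
  ∑-allFin-select fzero    f f≈0 = trans (∑-allFin-suc f)
    (trans (+-congˡ (∑-zero (allFin _) (λ j → f≈0 (fsuc j) (λ ())))) (+-identityʳ _))
  ∑-allFin-select (fsuc i) f f≈0 = trans (∑-allFin-suc f)
    (trans (+-cong (f≈0 fzero (λ ()))
                   (∑-allFin-select i (f ∘ fsuc) (λ j i≢j → f≈0 (fsuc j) (i≢j ∘ suc-injective))))
           (+-identityˡ _))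

  δ-diag : ∀ i → δ i i ≈ 1#
  δ-diag i with i ≟ i
  ... | yes _   = refl
  ... | no i≢i  = contradiction ≡.refl i≢i

  δ-≢ : ∀ {i j} → i ≢ j → δ i j ≈ 0#
  δ-≢ {i} {j} i≢j with i ≟ j
  ... | yes i≡j = contradiction i≡j i≢j
  ... | no _    = refl

  ∑-δ : ∀ i (x : Fin n → K) → ∑[ j ∈ allFin n ] (δ i j * x j) ≈ x i
  ∑-δ i x = trans (∑-allFin-select i _ (λ j i≢j → trans (*-congʳ (δ-≢ i≢j)) (zeroˡ _)))
                  (trans (*-congʳ (δ-diag i)) (*-identityˡ _))

  -- The ring of series

  ≋-setoid : Setoid c ℓ
  ≋-setoid = record
    { Carrier       = Ser
    ; _≈_           = _≋_
    ; isEquivalence = record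
      { refl  = λ _ _ → refl
      ; sym   = λ A≋B w v → sym (A≋B w v)
      ; trans = λ A≋B B≋C w v → trans (A≋B w v) (B≋C w v)
      }
    }

  open Setoid ≋-setoid public using () renaming (refl to ≋-refl; sym to ≋-sym; trans to ≋-trans)

  module ≋-Reasoning = SetoidReasoning ≋-setoid

  zeroS : Ser
  zeroS _ _ = 0#

  infixr 7 _·ₛ_
  _·ₛ_ : K → Ser → Ser
  (k ·ₛ A) w v = k * A w v

  Σₛ : List I → (I → Ser) → Ser
  Σₛ xs F w v = ∑[ x ∈ xs ] F x w v

  ⊕-cong : ∀ {A A′ B B′} → A ≋ A′ → B ≋ B′ → A ⊕ B ≋ A′ ⊕ B′
  ⊕-cong A≋A′ B≋B′ w v = +-cong (A≋A′ w v) (B≋B′ w v)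

  ⊖-cong : ∀ {A A′ B B′} → A ≋ A′ → B ≋ B′ → A ⊖ B ≋ A′ ⊖ B′
  ⊖-cong A≋A′ B≋B′ w v = +-cong (A≋A′ w v) (-‿cong (B≋B′ w v))

  ·ₛ-congʳ : ∀ k {A A′} → A ≋ A′ → k ·ₛ A ≋ k ·ₛ A′
  ·ₛ-congʳ k A≋A′ w v = *-congˡ (A≋A′ w v)

  Σₛ-cong : (xs : List I) {F G : I → Ser} → (∀ x → F x ≋ G x) → Σₛ xs F ≋ Σₛ xs G
  Σₛ-cong xs F≋G w v = ∑-cong xs (λ x → F≋G x w v)

  ⊛-expand : ∀ A B w v → (A ⊛ B) w v ≈
             ∑[ p ∈ splits w ] ∑[ q ∈ splits v ] (A (proj₁ p) (proj₁ q) * B (proj₂ p) (proj₂ q))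
  ⊛-expand A B w v = Σl-concatMap _ (splits w)

  ⊛-cong : ∀ {A A′ B B′} → A ≋ A′ → B ≋ B′ → A ⊛ B ≋ A′ ⊛ B′
  ⊛-cong {A} {A′} {B} {B′} A≋A′ B≋B′ w v = trans (⊛-expand A B w v) (trans
    (∑-cong (splits w) (λ p → ∑-cong (splits v) (λ q → *-cong (A≋A′ _ _) (B≋B′ _ _))))
    (sym (⊛-expand A′ B′ w v)))

  ⊛-congˡ : ∀ {A B B′} → B ≋ B′ → A ⊛ B ≋ A ⊛ B′
  ⊛-congˡ = ⊛-cong ≋-refl

  ⊛-congʳ : ∀ {A A′ B} → A ≋ A′ → A ⊛ B ≋ A′ ⊛ B
  ⊛-congʳ A≋A′ = ⊛-cong A≋A′ ≋-refl

  ∑-splits : ∀ a w (f : Word × Word → K) →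
             sumL (splits (a ∷ w)) f ≈ f ([] , a ∷ w) + ∑[ p ∈ splits w ] f (a ∷ proj₁ p , proj₂ p)
  ∑-splits a w f = +-congˡ (∑-map _ (splits w) f)

  ⊛-bilinear-+ : ∀ A B A₁ B₁ A₂ B₂ →
    (∀ w₁ v₁ w₂ v₂ →
       A w₁ v₁ * B w₂ v₂ ≈ A₁ w₁ v₁ * B₁ w₂ v₂ + A₂ w₁ v₁ * B₂ w₂ v₂) →
    A ⊛ B ≋ A₁ ⊛ B₁ ⊕ A₂ ⊛ B₂
  ⊛-bilinear-+ A B A₁ B₁ A₂ B₂ split w v = begin
    (A ⊛ B) w v ≈⟨ ⊛-expand A B w v ⟩
    _           ≈⟨ ∑-cong (splits w) (λ p → trans (∑-cong (splits v) (λ q → split _ _ _ _))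
                                                  (∑-distrib-+ (splits v) _ _)) ⟩
    _           ≈⟨ ∑-distrib-+ (splits w) _ _ ⟩
    _           ≈⟨ +-cong (⊛-expand A₁ B₁ w v) (⊛-expand A₂ B₂ w v) ⟨
    (A₁ ⊛ B₁ ⊕ A₂ ⊛ B₂) w v ∎
    where open ≈-Reasoning

  ⊛-bilinear-- : ∀ A B A₁ B₁ A₂ B₂ →
    (∀ w₁ v₁ w₂ v₂ →
       A w₁ v₁ * B w₂ v₂ ≈ A₁ w₁ v₁ * B₁ w₂ v₂ - A₂ w₁ v₁ * B₂ w₂ v₂) →
    A ⊛ B ≋ A₁ ⊛ B₁ ⊖ A₂ ⊛ B₂
  ⊛-bilinear-- A B A₁ B₁ A₂ B₂ split w v = begin
    (A ⊛ B) w v ≈⟨ ⊛-expand A B w v ⟩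
    _           ≈⟨ ∑-cong (splits w) (λ p → trans (∑-cong (splits v) (λ q → split _ _ _ _))
                                                  (∑-distrib-- (splits v) _ _)) ⟩
    _           ≈⟨ ∑-distrib-- (splits w) _ _ ⟩
    _           ≈⟨ +-cong (⊛-expand A₁ B₁ w v) (-‿cong (⊛-expand A₂ B₂ w v)) ⟨
    (A₁ ⊛ B₁ ⊖ A₂ ⊛ B₂) w v ∎
    where open ≈-Reasoning

  ⊛-bilinear-· : ∀ k A B A₁ B₁ →
    (∀ w₁ v₁ w₂ v₂ → A w₁ v₁ * B w₂ v₂ ≈ k * (A₁ w₁ v₁ * B₁ w₂ v₂)) →
    A ⊛ B ≋ k ·ₛ (A₁ ⊛ B₁)
  ⊛-bilinear-· k A B A₁ B₁ split w v = begin
    (A ⊛ B) w v ≈⟨ ⊛-expand A B w v ⟩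
    _           ≈⟨ ∑-cong (splits w) (λ p → trans (∑-cong (splits v) (λ q → split _ _ _ _))
                                                  (sym (*-distribˡ-∑ k (splits v) _))) ⟩
    _           ≈⟨ *-distribˡ-∑ k (splits w) _ ⟨
    _           ≈⟨ *-congˡ (⊛-expand A₁ B₁ w v) ⟨
    (k ·ₛ (A₁ ⊛ B₁)) w v ∎
    where open ≈-Reasoning

  ⊛-distribˡ : ∀ A B C → A ⊛ (B ⊕ C) ≋ A ⊛ B ⊕ A ⊛ C
  ⊛-distribˡ A B C = ⊛-bilinear-+ _ _ _ _ _ _ (λ _ _ _ _ → distribˡ _ _ _)

  ⊛-distribʳ : ∀ A B C → (B ⊕ C) ⊛ A ≋ B ⊛ A ⊕ C ⊛ A
  ⊛-distribʳ A B C = ⊛-bilinear-+ _ _ _ _ _ _ (λ _ _ _ _ → distribʳ _ _ _)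

  ⊛-distribʳ-⊖ : ∀ A B C → (B ⊖ C) ⊛ A ≋ B ⊛ A ⊖ C ⊛ A
  ⊛-distribʳ-⊖ A B C = ⊛-bilinear-- _ _ _ _ _ _ (λ _ _ _ _ → [y-z]x≈yx-zx _ _ _)

  ·ₛ-⊛ : ∀ k A B → (k ·ₛ A) ⊛ B ≋ k ·ₛ (A ⊛ B)
  ·ₛ-⊛ k A B = ⊛-bilinear-· k _ _ _ _ (λ _ _ _ _ → *-assoc _ _ _)

  ⊛-·ₛ : ∀ k A B → A ⊛ (k ·ₛ B) ≋ k ·ₛ (A ⊛ B)
  ⊛-·ₛ k A B = ⊛-bilinear-· k _ _ _ _ (λ _ _ _ _ → x*[k*y]≈k*[x*y] _ _ _)
    where
    x*[k*y]≈k*[x*y] : ∀ x k y → x * (k * y) ≈ k * (x * y)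
    x*[k*y]≈k*[x*y] x k y = trans (sym (*-assoc x k y)) (trans (*-congʳ (*-comm x k)) (*-assoc k x y))

  ⊛-zeroʳ : ∀ A → A ⊛ zeroS ≋ zeroS
  ⊛-zeroʳ A w v =
    trans (⊛-expand A zeroS w v) (∑-zero (splits w) (λ _ → ∑-zero (splits v) (λ _ → zeroʳ _)))

  ⊛-Σₛ : ∀ A (xs : List I) F → A ⊛ Σₛ xs F ≋ Σₛ xs (λ x → A ⊛ F x)
  ⊛-Σₛ A xs F w v = begin
    (A ⊛ Σₛ xs F) w v ≈⟨ ⊛-expand A _ w v ⟩
    _ ≈⟨ ∑-cong (splits w) (λ p → ∑-cong (splits v) (λ q → *-distribˡ-∑ _ xs _)) ⟩
    _ ≈⟨ ∑-cong (splits w) (λ p → ∑-comm (splits v) xs _) ⟩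
    _ ≈⟨ ∑-comm (splits w) xs _ ⟩
    _ ≈⟨ ∑-cong xs (λ x → ⊛-expand A (F x) w v) ⟨
    Σₛ xs (λ x → A ⊛ F x) w v ∎
    where open ≈-Reasoning

  Σₛ-⊛ : ∀ A (xs : List I) F → Σₛ xs F ⊛ A ≋ Σₛ xs (λ x → F x ⊛ A)
  Σₛ-⊛ A xs F w v = begin
    (Σₛ xs F ⊛ A) w v ≈⟨ ⊛-expand _ A w v ⟩
    _ ≈⟨ ∑-cong (splits w) (λ p → ∑-cong (splits v) (λ q → *-distribʳ-∑ _ xs _)) ⟩
    _ ≈⟨ ∑-cong (splits w) (λ p → ∑-comm (splits v) xs _) ⟩
    _ ≈⟨ ∑-comm (splits w) xs _ ⟩
    _ ≈⟨ ∑-cong xs (λ x → ⊛-expand (F x) A w v) ⟨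
    Σₛ xs (λ x → F x ⊛ A) w v ∎
    where open ≈-Reasoning

  ε₀ : Word → K
  ε₀ []      = 1#
  ε₀ (_ ∷ _) = 0#

  one≈ε₀*ε₀ : ∀ w v → one w v ≈ ε₀ w * ε₀ v
  one≈ε₀*ε₀ []      []      = sym (*-identityˡ _)
  one≈ε₀*ε₀ []      (_ ∷ _) = sym (*-identityˡ _)
  one≈ε₀*ε₀ (_ ∷ _) v       = sym (zeroˡ _)

  ∑-splits-ε₀ˡ : ∀ w (g : Word → K) → ∑[ p ∈ splits w ] (ε₀ (proj₁ p) * g (proj₂ p)) ≈ g w
  ∑-splits-ε₀ˡ []      g = trans (+-identityʳ _) (*-identityˡ _)
  ∑-splits-ε₀ˡ (a ∷ w) g = trans (∑-splits a w _)
    (trans (+-congˡ (∑-zero (splits w) (λ _ → zeroˡ _))) (trans (+-identityʳ _) (*-identityˡ _)))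

  ∑-splits-ε₀ʳ : ∀ w (g : Word → K) → ∑[ p ∈ splits w ] (g (proj₁ p) * ε₀ (proj₂ p)) ≈ g w
  ∑-splits-ε₀ʳ []      g = trans (+-identityʳ _) (*-identityʳ _)
  ∑-splits-ε₀ʳ (a ∷ w) g = trans (∑-splits a w _)
    (trans (+-cong (zeroʳ _) (∑-splits-ε₀ʳ w (λ u → g (a ∷ u)))) (+-identityˡ _))

  ⊛-identityˡ : ∀ A → one ⊛ A ≋ A
  ⊛-identityˡ A w v = begin
    (one ⊛ A) w v
      ≈⟨ ⊛-expand one A w v ⟩
    ∑[ p ∈ splits w ] ∑[ q ∈ splits v ] (one (proj₁ p) (proj₁ q) * A (proj₂ p) (proj₂ q))
      ≈⟨ ∑-cong (splits w) (λ p → trans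
           (∑-cong (splits v) (λ q → trans (*-congʳ (one≈ε₀*ε₀ (proj₁ p) (proj₁ q))) (*-assoc _ _ _)))
           (sym (*-distribˡ-∑ _ (splits v) _))) ⟩
    ∑[ p ∈ splits w ] (ε₀ (proj₁ p) * ∑[ q ∈ splits v ] (ε₀ (proj₁ q) * A (proj₂ p) (proj₂ q)))
      ≈⟨ ∑-cong (splits w) (λ p → *-congˡ (∑-splits-ε₀ˡ v (A (proj₂ p)))) ⟩
    ∑[ p ∈ splits w ] (ε₀ (proj₁ p) * A (proj₂ p) v)
      ≈⟨ ∑-splits-ε₀ˡ w (λ u → A u v) ⟩
    A w v ∎
    where open ≈-Reasoning

  ⊛-identityʳ : ∀ A → A ⊛ one ≋ A
  ⊛-identityʳ A w v = begin
    (A ⊛ one) w v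
      ≈⟨ ⊛-expand A one w v ⟩
    ∑[ p ∈ splits w ] ∑[ q ∈ splits v ] (A (proj₁ p) (proj₁ q) * one (proj₂ p) (proj₂ q))
      ≈⟨ ∑-cong (splits w) (λ p → ∑-cong (splits v) (λ q →
           trans (*-congˡ (one≈ε₀*ε₀ (proj₂ p) (proj₂ q))) (middle _ _ _))) ⟩
    ∑[ p ∈ splits w ] ∑[ q ∈ splits v ] ((A (proj₁ p) (proj₁ q) * ε₀ (proj₂ q)) * ε₀ (proj₂ p))
      ≈⟨ ∑-cong (splits w) (λ p → trans (sym (*-distribʳ-∑ _ (splits v) _))
                                         (*-congʳ (∑-splits-ε₀ʳ v (A (proj₁ p))))) ⟩
    ∑[ p ∈ splits w ] (A (proj₁ p) v * ε₀ (proj₂ p))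
      ≈⟨ ∑-splits-ε₀ʳ w (λ u → A u v) ⟩
    A w v ∎
    where
    open ≈-Reasoning
    middle : ∀ a e f → a * (e * f) ≈ (a * f) * e
    middle a e f = trans (*-congˡ (*-comm e f)) (sym (*-assoc a f e))

  ∑-splits-assoc : ∀ w (f : Word → Word → Word → K) →
    ∑[ p ∈ splits w ] ∑[ q ∈ splits (proj₁ p) ] f (proj₁ q) (proj₂ q) (proj₂ p) ≈
    ∑[ p ∈ splits w ] ∑[ q ∈ splits (proj₂ p) ] f (proj₁ p) (proj₁ q) (proj₂ q)
  ∑-splits-assoc []      f = refl
  ∑-splits-assoc (a ∷ w) f = begin
    (f [] [] (a ∷ w) + 0#) + sumL (map _ (splits w)) _
      ≈⟨ +-congˡ (∑-map _ (splits w) _) ⟩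
    (f [] [] (a ∷ w) + 0#) +
      ∑[ p ∈ splits w ] (f [] (a ∷ proj₁ p) (proj₂ p) + sumL (map _ (splits (proj₁ p))) _)
      ≈⟨ +-congˡ (∑-cong (splits w) (λ p → +-congˡ (∑-map _ (splits (proj₁ p)) _))) ⟩
    (f [] [] (a ∷ w) + 0#) +
      ∑[ p ∈ splits w ] (f [] (a ∷ proj₁ p) (proj₂ p) +
                         ∑[ q ∈ splits (proj₁ p) ] f (a ∷ proj₁ q) (proj₂ q) (proj₂ p))
      ≈⟨ +-congˡ (∑-distrib-+ (splits w) _ _) ⟩
    (f [] [] (a ∷ w) + 0#) +
      (∑[ p ∈ splits w ] f [] (a ∷ proj₁ p) (proj₂ p) +
       ∑[ p ∈ splits w ] ∑[ q ∈ splits (proj₁ p) ] f (a ∷ proj₁ q) (proj₂ q) (proj₂ p))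
      ≈⟨ trans (+-congʳ (+-identityʳ _)) (sym (+-assoc _ _ _)) ⟩
    (f [] [] (a ∷ w) + ∑[ p ∈ splits w ] f [] (a ∷ proj₁ p) (proj₂ p)) +
      ∑[ p ∈ splits w ] ∑[ q ∈ splits (proj₁ p) ] f (a ∷ proj₁ q) (proj₂ q) (proj₂ p)
      ≈⟨ +-cong (sym (∑-splits a w _)) (∑-splits-assoc w (λ x → f (a ∷ x))) ⟩
    ∑[ q ∈ splits (a ∷ w) ] f [] (proj₁ q) (proj₂ q) +
      ∑[ p ∈ splits w ] ∑[ q ∈ splits (proj₂ p) ] f (a ∷ proj₁ p) (proj₁ q) (proj₂ q)
      ≈⟨ sym (∑-splits a w _) ⟩
    ∑[ p ∈ splits (a ∷ w) ] ∑[ q ∈ splits (proj₂ p) ] f (proj₁ p) (proj₁ q) (proj₂ q) ∎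
    where open ≈-Reasoning

  ⊛-assoc : ∀ A B C → (A ⊛ B) ⊛ C ≋ A ⊛ (B ⊛ C)
  ⊛-assoc A B C w v = begin
    ((A ⊛ B) ⊛ C) w v
      ≈⟨ ⊛-expand (A ⊛ B) C w v ⟩
    ∑[ p ∈ splits w ] ∑[ r ∈ splits v ] ((A ⊛ B) (proj₁ p) (proj₁ r) * C (proj₂ p) (proj₂ r))
      ≈⟨ ∑-cong (splits w) (λ p → ∑-cong (splits v) (λ r →
           expandˡ (proj₁ p) (proj₂ p) (proj₁ r) (proj₂ r))) ⟩
    ∑[ p ∈ splits w ] ∑[ r ∈ splits v ] ∑[ p′ ∈ splits (proj₁ p) ] ∑[ r′ ∈ splits (proj₁ r) ]
      g (proj₁ p′) (proj₂ p′) (proj₂ p) (proj₁ r′) (proj₂ r′) (proj₂ r)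
      ≈⟨ ∑-cong (splits w) (λ p → ∑-comm (splits v) (splits (proj₁ p)) _) ⟩
    ∑[ p ∈ splits w ] ∑[ p′ ∈ splits (proj₁ p) ] ∑[ r ∈ splits v ] ∑[ r′ ∈ splits (proj₁ r) ]
      g (proj₁ p′) (proj₂ p′) (proj₂ p) (proj₁ r′) (proj₂ r′) (proj₂ r)
      ≈⟨ ∑-cong (splits w) (λ p → ∑-cong (splits (proj₁ p)) (λ p′ →
           ∑-splits-assoc v (g (proj₁ p′) (proj₂ p′) (proj₂ p)))) ⟩
    ∑[ p ∈ splits w ] ∑[ p′ ∈ splits (proj₁ p) ] h (proj₁ p′) (proj₂ p′) (proj₂ p)
      ≈⟨ ∑-splits-assoc w h ⟩
    ∑[ p ∈ splits w ] ∑[ p′ ∈ splits (proj₂ p) ] h (proj₁ p) (proj₁ p′) (proj₂ p′)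
      ≈⟨ ∑-cong (splits w) (λ p → ∑-comm (splits v) (splits (proj₂ p)) _) ⟨
    ∑[ p ∈ splits w ] ∑[ r ∈ splits v ] ∑[ p′ ∈ splits (proj₂ p) ] ∑[ r′ ∈ splits (proj₂ r) ]
      g (proj₁ p) (proj₁ p′) (proj₂ p′) (proj₁ r) (proj₁ r′) (proj₂ r′)
      ≈⟨ ∑-cong (splits w) (λ p → ∑-cong (splits v) (λ r →
           expandʳ (proj₁ p) (proj₂ p) (proj₁ r) (proj₂ r))) ⟨
    ∑[ p ∈ splits w ] ∑[ r ∈ splits v ] (A (proj₁ p) (proj₁ r) * (B ⊛ C) (proj₂ p) (proj₂ r))
      ≈⟨ ⊛-expand A (B ⊛ C) w v ⟨
    (A ⊛ (B ⊛ C)) w v ∎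
    where
    open ≈-Reasoning
    g : Word → Word → Word → Word → Word → Word → K
    g w₁ w₂ w₃ v₁ v₂ v₃ = A w₁ v₁ * (B w₂ v₂ * C w₃ v₃)

    h : Word → Word → Word → K
    h w₁ w₂ w₃ =
      ∑[ r ∈ splits v ] ∑[ r′ ∈ splits (proj₂ r) ] g w₁ w₂ w₃ (proj₁ r) (proj₁ r′) (proj₂ r′)

    expandˡ : ∀ w₁₂ w₃ v₁₂ v₃ → (A ⊛ B) w₁₂ v₁₂ * C w₃ v₃ ≈
      ∑[ p′ ∈ splits w₁₂ ] ∑[ r′ ∈ splits v₁₂ ]
        g (proj₁ p′) (proj₂ p′) w₃ (proj₁ r′) (proj₂ r′) v₃
    expandˡ w₁₂ w₃ v₁₂ v₃ =
      trans (*-congʳ (⊛-expand A B w₁₂ v₁₂)) (trans (*-distribʳ-∑ _ (splits w₁₂) _)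
      (∑-cong (splits w₁₂) (λ p′ → trans (*-distribʳ-∑ _ (splits v₁₂) _)
                                         (∑-cong (splits v₁₂) (λ r′ → *-assoc _ _ _)))))

    expandʳ : ∀ w₁ w₂₃ v₁ v₂₃ → A w₁ v₁ * (B ⊛ C) w₂₃ v₂₃ ≈
      ∑[ p′ ∈ splits w₂₃ ] ∑[ r′ ∈ splits v₂₃ ]
        g w₁ (proj₁ p′) (proj₂ p′) v₁ (proj₁ r′) (proj₂ r′)
    expandʳ w₁ w₂₃ v₁ v₂₃ =
      trans (*-congˡ (⊛-expand B C w₂₃ v₂₃)) (trans (*-distribˡ-∑ _ (splits w₂₃) _)
      (∑-cong (splits w₂₃) (λ p′ → *-distribˡ-∑ _ (splits v₂₃) _)))

  ⊛-cancel-inner : ∀ A B C D → B ⊛ C ≋ one → (A ⊛ B) ⊛ (C ⊛ D) ≋ A ⊛ D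
  ⊛-cancel-inner A B C D BC≋1 = begin
    (A ⊛ B) ⊛ (C ⊛ D) ≈⟨ ⊛-assoc A B (C ⊛ D) ⟩
    A ⊛ (B ⊛ (C ⊛ D)) ≈⟨ ⊛-congˡ (⊛-assoc B C D) ⟨
    A ⊛ ((B ⊛ C) ⊛ D) ≈⟨ ⊛-congˡ (⊛-congʳ BC≋1) ⟩
    A ⊛ (one ⊛ D)     ≈⟨ ⊛-congˡ (⊛-identityˡ D) ⟩
    A ⊛ D             ∎
    where open ≋-Reasoning

  deg : Word → Word → ℕ
  deg w v = length w +ℕ length v

  -- inv and subst truncate at the total degree of the coefficient they compute, so their
  -- algebraic laws are proved by comparing series below a given degree.
  infix 4 _≈<[_]_
  _≈<[_]_ : Ser → ℕ → Ser → Set ℓ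
  A ≈<[ N ] B = ∀ w v → deg w v < N → A w v ≈ B w v

  ≋⇒≈< : ∀ {A B} N → A ≋ B → A ≈<[ N ] B
  ≋⇒≈< N A≋B w v _ = A≋B w v

  ≈<-refl : ∀ {A N} → A ≈<[ N ] A
  ≈<-refl w v _ = refl

  ≈<-sym : ∀ {A B N} → A ≈<[ N ] B → B ≈<[ N ] A
  ≈<-sym A≈B w v d<N = sym (A≈B w v d<N)

  ≈<-trans : ∀ {A B C N} → A ≈<[ N ] B → B ≈<[ N ] C → A ≈<[ N ] C
  ≈<-trans A≈B B≈C w v d<N = trans (A≈B w v d<N) (B≈C w v d<N)

  ⊕-cong< : ∀ {A A′ B B′ N} → A ≈<[ N ] A′ → B ≈<[ N ] B′ → A ⊕ B ≈<[ N ] A′ ⊕ B′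
  ⊕-cong< A≈A′ B≈B′ w v d<N = +-cong (A≈A′ w v d<N) (B≈B′ w v d<N)

  Σₛ-cong< : ∀ {N} (xs : List I) {F G : I → Ser} →
             (∀ x → F x ≈<[ N ] G x) → Σₛ xs F ≈<[ N ] Σₛ xs G
  Σₛ-cong< xs F≈G w v d<N = ∑-cong xs (λ x → F≈G x w v d<N)

  ∑-splits-cong : ∀ w {f g : Word × Word → K} →
                  (∀ w₁ w₂ → w₁ ++ w₂ ≡ w → f (w₁ , w₂) ≈ g (w₁ , w₂)) →
                  sumL (splits w) f ≈ sumL (splits w) g
  ∑-splits-cong []      f≈g = +-congʳ (f≈g [] [] ≡.refl)
  ∑-splits-cong (a ∷ w) f≈g = trans (∑-splits a w _) (trans
    (+-cong (f≈g [] (a ∷ w) ≡.refl)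
            (∑-splits-cong w (λ w₁ w₂ eq → f≈g (a ∷ w₁) w₂ (≡.cong (a ∷_) eq))))
    (sym (∑-splits a w _)))

  ++-length-≤ˡ : ∀ (w₁ w₂ : Word) {w} → w₁ ++ w₂ ≡ w → length w₁ ≤ length w
  ++-length-≤ˡ w₁ w₂ ≡.refl = List.length-++-≤ˡ w₁

  ++-length-≤ʳ : ∀ (w₁ w₂ : Word) {w} → w₁ ++ w₂ ≡ w → length w₂ ≤ length w
  ++-length-≤ʳ w₁ w₂ ≡.refl = List.length-++-≤ʳ w₂ {w₁}

  ++-length-<ʳ : ∀ a (w₁ w₂ : Word) {w} → (a ∷ w₁) ++ w₂ ≡ w → length w₂ < length w
  ++-length-<ʳ a w₁ w₂ ≡.refl = s≤s (List.length-++-≤ʳ w₂ {w₁})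

  ⊛-cong< : ∀ {A A′ B B′ N} → A ≈<[ N ] A′ → B ≈<[ N ] B′ → A ⊛ B ≈<[ N ] A′ ⊛ B′
  ⊛-cong< {A} {A′} {B} {B′} A≈A′ B≈B′ w v d<N = trans (⊛-expand A B w v) (trans
    (∑-splits-cong w (λ w₁ w₂ eqw → ∑-splits-cong v (λ v₁ v₂ eqv → *-cong
       (A≈A′ w₁ v₁ (≤-<-trans (+-mono-≤ (++-length-≤ˡ w₁ w₂ eqw) (++-length-≤ˡ v₁ v₂ eqv)) d<N))
       (B≈B′ w₂ v₂ (≤-<-trans (+-mono-≤ (++-length-≤ʳ w₁ w₂ eqw) (++-length-≤ʳ v₁ v₂ eqv)) d<N)))))
    (sym (⊛-expand A′ B′ w v)))

  noConst-⊛-cong< : ∀ {A B B′ N} → A [] [] ≈ 0# → B ≈<[ N ] B′ → A ⊛ B ≈<[ suc N ] A ⊛ B′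
  noConst-⊛-cong< {A} {B} {B′} {N} A₀≈0 B≈B′ w v d<1+N = trans (⊛-expand A B w v) (trans
    (∑-splits-cong w (λ w₁ w₂ eqw → ∑-splits-cong v (λ v₁ v₂ eqv → term w₁ w₂ v₁ v₂ eqw eqv)))
    (sym (⊛-expand A B′ w v)))
    where
    term : ∀ w₁ w₂ v₁ v₂ → w₁ ++ w₂ ≡ w → v₁ ++ v₂ ≡ v →
           A w₁ v₁ * B w₂ v₂ ≈ A w₁ v₁ * B′ w₂ v₂
    term []       w₂ []       v₂ eqw eqv =
      trans (*-congʳ A₀≈0) (trans (zeroˡ _) (sym (trans (*-congʳ A₀≈0) (zeroˡ _))))
    term (a ∷ w₁) w₂ v₁       v₂ eqw eqv = *-congˡ (B≈B′ w₂ v₂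
      (≤-pred (<-≤-trans (s≤s (+-mono-<-≤ (++-length-<ʳ a w₁ w₂ eqw) (++-length-≤ʳ v₁ v₂ eqv)))
                         d<1+N)))
    term []       w₂ (b ∷ v₁) v₂ eqw eqv = *-congˡ (B≈B′ w₂ v₂
      (≤-pred (<-≤-trans (s≤s (+-mono-≤-< (++-length-≤ʳ [] w₂ eqw) (++-length-<ʳ b v₁ v₂ eqv)))
                         d<1+N)))

  ≈-stable : (f : ℕ → K) {M : ℕ} → (∀ k → M ≤ k → f k ≈ f (suc k)) →
             ∀ {M′} → M ≤ M′ → f M ≈ f M′
  ≈-stable f {M} step M≤M′ = go (≤⇒≤′ M≤M′)
    where
    go : ∀ {M′} → M ≤′ M′ → f M ≈ f M′
    go ≤′-refl         = refl
    go (≤′-step M≤′M′) = trans (go M≤′M′) (step _ (≤′⇒≤ M≤′M′))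

  -- Inverses

  -- Truncating inv A = Σₖ (1 - A)ᵏ at k < M gives a geometric sum whose product with A is
  -- 1 - (1 - A)ᴹ, and (1 - A)ᴹ vanishes below degree M.
  module Inverse (A : Ser) (A₀≈1 : A [] [] ≈ 1#) where
    N : Ser
    N = one ⊖ A

    N₀≈0 : N [] [] ≈ 0#
    N₀≈0 = trans (+-congˡ (-‿cong A₀≈1)) (-‿inverseʳ 1#)

    pow-vanish : ∀ k → pow N k ≈<[ k ] zeroS
    pow-vanish zero    w v ()
    pow-vanish (suc k) = ≈<-trans (noConst-⊛-cong< N₀≈0 (pow-vanish k)) (≋⇒≈< (suc k) (⊛-zeroʳ N))

    geometric : ℕ → Ser
    geometric M = Σₛ (upTo M) (pow N)

    geometric-sucʳ : ∀ M → geometric (suc M) ≋ geometric M ⊕ pow N M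
    geometric-sucʳ M w v = ∑-applyUpTo-suc (λ k → k) M (λ k → pow N k w v)

    geometric-sucˡ : ∀ M → geometric (suc M) ≋ one ⊕ N ⊛ geometric M
    geometric-sucˡ M w v =
      trans (∑-upTo-suc M (λ k → pow N k w v)) (+-congˡ (sym (⊛-Σₛ N (upTo M) (pow N) w v)))

    ⊛-geometric : ∀ M → A ⊛ geometric M ≋ one ⊖ pow N M
    ⊛-geometric M w v = begin
      (A ⊛ G) w v                 ≈⟨ ⊛-congʳ (λ w v → a≈o-[o-a] (one w v) (A w v)) w v ⟩
      ((one ⊖ N) ⊛ G) w v         ≈⟨ ⊛-distribʳ-⊖ G one N w v ⟩
      (one ⊛ G) w v - (N ⊛ G) w v ≈⟨ +-congʳ (⊛-identityˡ G w v) ⟩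
      G w v - (N ⊛ G) w v         ≈⟨ telescope (sym (geometric-sucˡ M w v)) (geometric-sucʳ M w v) ⟩
      one w v - pow N M w v       ∎
      where
      open ≈-Reasoning
      G : Ser
      G = geometric M

      a≈o-[o-a] : ∀ o a → a ≈ o - (o - a)
      a≈o-[o-a] o a = sym (begin
        o - (o - a)   ≈⟨ +-congˡ (⁻¹-anti-homo‿- o a) ⟩
        o + (a - o)   ≈⟨ +-assoc o a (- o) ⟨
        (o + a) - o   ≈⟨ +-congʳ (+-comm o a) ⟩
        (a + o) - o   ≈⟨ x+y-y≈x a o ⟩
        a             ∎)

      telescope : ∀ {s o x t p} → o + x ≈ s → s ≈ t + p → t - x ≈ o - p
      telescope {s} {o} {x} {t} {p} o+x≈s s≈t+p = begin
        t - x             ≈⟨ +-congʳ (x+y-y≈x t p) ⟨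
        ((t + p) - p) - x ≈⟨ +-congʳ (+-congʳ (trans (sym s≈t+p) (sym o+x≈s))) ⟩
        ((o + x) - p) - x ≈⟨ +-congʳ (swap o x p) ⟩
        ((o - p) + x) - x ≈⟨ x+y-y≈x (o - p) x ⟩
        o - p             ∎
        where
        swap : ∀ o x p → (o + x) - p ≈ (o - p) + x
        swap = solve 3 (λ o x p → ((o :+ x) :+ :- p) ⊜ ((o :+ :- p) :+ x)) refl

    inv≈<geometric : ∀ M → inv A ≈<[ M ] geometric M
    inv≈<geometric M w v d<M = ≈-stable (λ k → geometric k w v) step d<M
      where
      step : ∀ k → suc (deg w v) ≤ k → geometric k w v ≈ geometric (suc k) w v
      step k d<k = sym (trans (geometric-sucʳ k w v) (trans (+-congˡ (pow-vanish k w v d<k)) (+-identityʳ _)))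

    inv-inverseʳ : A ⊛ inv A ≋ one
    inv-inverseʳ w v = begin
      (A ⊛ inv A) w v       ≈⟨ ⊛-cong< (≈<-refl {A}) (inv≈<geometric M) w v ≤-refl ⟩
      (A ⊛ geometric M) w v ≈⟨ ⊛-geometric M w v ⟩
      one w v - pow N M w v ≈⟨ +-congˡ (trans (-‿cong (pow-vanish M w v ≤-refl)) -0#≈0#) ⟩
      one w v + 0#          ≈⟨ +-identityʳ _ ⟩
      one w v               ∎
      where
      open ≈-Reasoning
      M : ℕ
      M = suc (deg w v)

  inv-inverseʳ : ∀ {A} → A [] [] ≈ 1# → A ⊛ inv A ≋ one
  inv-inverseʳ {A} A₀≈1 = Inverse.inv-inverseʳ A A₀≈1

  inv₀≈1 : ∀ A → inv A [] [] ≈ 1#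
  inv₀≈1 A = +-identityʳ 1#

  inverse-unique : ∀ {L A R} → L ⊛ A ≋ one → A ⊛ R ≋ one → L ≋ R
  inverse-unique {L} {A} {R} LA≋1 AR≋1 = begin
    L           ≈⟨ ⊛-identityʳ L ⟨
    L ⊛ one     ≈⟨ ⊛-congˡ AR≋1 ⟨
    L ⊛ (A ⊛ R) ≈⟨ ⊛-assoc L A R ⟨
    (L ⊛ A) ⊛ R ≈⟨ ⊛-congʳ LA≋1 ⟩
    one ⊛ R     ≈⟨ ⊛-identityˡ R ⟩
    R           ∎
    where open ≋-Reasoning

  inv-inverseˡ : ∀ {A} → A [] [] ≈ 1# → inv A ⊛ A ≋ one
  inv-inverseˡ {A} A₀≈1 = ≋-trans (⊛-congˡ A≋inv[invA]) (inv-inverseʳ (inv₀≈1 A))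
    where
    A≋inv[invA] : A ≋ inv (inv A)
    A≋inv[invA] = inverse-unique (inv-inverseʳ A₀≈1) (inv-inverseʳ (inv₀≈1 A))

  inv-unique : ∀ {A B} → A [] [] ≈ 1# → A ⊛ B ≋ one → inv A ≋ B
  inv-unique A₀≈1 = inverse-unique (inv-inverseˡ A₀≈1)

  inv-uniqueˡ : ∀ {A B} → A [] [] ≈ 1# → B ⊛ A ≋ one → B ≋ inv A
  inv-uniqueˡ A₀≈1 BA≋1 = inverse-unique BA≋1 (inv-inverseʳ A₀≈1)

  -- Substitution

  substN : ℕ → ZSer → (Fin n → Ser) → Ser
  substN N g S = Σₛ (wordsUpTo N) (λ u → g u ·ₛ prodS S u)

  NoConst : (Fin n → Ser) → Set ℓ
  NoConst S = ∀ i → S i [] [] ≈ 0#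

  ∂ : Fin n → ZSer → ZSer
  ∂ i g u = g (i ∷ u)

  substN-zero : ∀ g S → substN 0 g S ≋ g [] ·ₛ one
  substN-zero g S w v = +-identityʳ _

  substN-suc : ∀ N g S →
    substN (suc N) g S ≋ g [] ·ₛ one ⊕ Σₛ (allFin n) (λ i → S i ⊛ substN N (∂ i g) S)
  substN-suc N g S w v = trans (∑-wordsUpTo-suc N (λ u → g u * prodS S u w v))
    (+-congˡ (∑-cong (allFin n) (λ i → trans
       (∑-cong (wordsUpTo N) (λ u → sym (⊛-·ₛ (g (i ∷ u)) (S i) (prodS S u) w v)))
       (sym (⊛-Σₛ (S i) (wordsUpTo N) (λ u → g (i ∷ u) ·ₛ prodS S u) w v)))))

  substN-cong : ∀ N {g h} S → (∀ u → g u ≈ h u) → substN N g S ≋ substN N h S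
  substN-cong N S g≈h w v = ∑-cong (wordsUpTo N) (λ u → *-congʳ (g≈h u))

  substN-cong-≤ : ∀ N {g h} S → (∀ u → length u ≤ N → g u ≈ h u) → substN N g S ≋ substN N h S
  substN-cong-≤ zero    {g} {h} S g≈h = ≋-trans (substN-zero g S)
    (≋-trans (λ w v → *-congʳ (g≈h [] z≤n)) (≋-sym (substN-zero h S)))
  substN-cong-≤ (suc N) {g} {h} S g≈h = ≋-trans (substN-suc N g S) (≋-trans
    (⊕-cong (λ w v → *-congʳ (g≈h [] z≤n))
            (Σₛ-cong (allFin n) (λ i → ⊛-congˡ
              (substN-cong-≤ N S (λ u |u|≤N → g≈h (i ∷ u) (s≤s |u|≤N))))))
    (≋-sym (substN-suc N h S)))

  substN-+ : ∀ N g h S → substN N (λ u → g u + h u) S ≋ substN N g S ⊕ substN N h S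
  substN-+ N g h S w v = trans (∑-cong (wordsUpTo N) (λ u → distribʳ _ _ _)) (∑-distrib-+ (wordsUpTo N) _ _)

  substN-· : ∀ N k g S → substN N (λ u → k * g u) S ≋ k ·ₛ substN N g S
  substN-· N k g S w v =
    trans (∑-cong (wordsUpTo N) (λ u → *-assoc _ _ _)) (sym (*-distribˡ-∑ k (wordsUpTo N) _))

  substN-∑ : ∀ N (xs : List I) (f : I → ZSer) S →
             substN N (λ u → ∑[ x ∈ xs ] f x u) S ≋ Σₛ xs (λ x → substN N (f x) S)
  substN-∑ N xs f S w v =
    trans (∑-cong (wordsUpTo N) (λ u → *-distribʳ-∑ _ xs _)) (∑-comm (wordsUpTo N) xs _)

  substN-const : ∀ N g S → (∀ i u → g (i ∷ u) ≈ 0#) → substN N g S ≋ g [] ·ₛ one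
  substN-const zero    g S _     = substN-zero g S
  substN-const (suc N) g S ∂g≈0 = ≋-trans (substN-suc N g S) (λ w v → trans
    (+-congˡ (∑-zero (allFin n) (λ i → trans (⊛-congˡ (substN-cong N S (∂g≈0 i)) w v) (vanish i w v))))
    (+-identityʳ _))
    where
    vanish : ∀ i → S i ⊛ substN N (λ _ → 0#) S ≋ zeroS
    vanish i = ≋-trans (⊛-congˡ (λ w v → ∑-zero (wordsUpTo N) (λ _ → zeroˡ _))) (⊛-zeroʳ (S i))

  subst-cong : ∀ {g h} S → (∀ u → g u ≈ h u) → subst g S ≋ subst h S
  subst-cong S g≈h w v = substN-cong (deg w v) S g≈h w v

  prodS-cong : ∀ {S S′ : Fin n → Ser} → (∀ i → S i ≋ S′ i) → ∀ u → prodS S u ≋ prodS S′ u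
  prodS-cong S≋S′ []      = ≋-refl
  prodS-cong S≋S′ (i ∷ u) = ⊛-cong (S≋S′ i) (prodS-cong S≋S′ u)

  subst-congʳ : ∀ g {S S′ : Fin n → Ser} → (∀ i → S i ≋ S′ i) → subst g S ≋ subst g S′
  subst-congʳ g S≋S′ w v = ∑-cong (wordsUpTo (deg w v)) (λ u → *-congˡ (prodS-cong S≋S′ u w v))

  subst-+ : ∀ g h S → subst (λ u → g u + h u) S ≋ subst g S ⊕ subst h S
  subst-+ g h S w v = substN-+ (deg w v) g h S w v

  subst-const : ∀ g S → (∀ i u → g (i ∷ u) ≈ 0#) → subst g S ≋ g [] ·ₛ one
  subst-const g S ∂g≈0 w v = substN-const (deg w v) g S ∂g≈0 w v

  subst-one : ∀ S → subst (one []) S ≋ one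
  subst-one S w v = trans (subst-const (one []) S (λ _ _ → refl) w v) (*-identityˡ _)

  subst₀ : ∀ g S → subst g S [] [] ≈ g []
  subst₀ g S = trans (+-identityʳ _) (*-identityʳ _)

  subst-mgf : ∀ {m} S → m [] ≈ 1# → subst m S ≋ one ⊕ subst (mgf m) S
  subst-mgf {m} S m₀≈1 =
    ≋-trans (subst-cong S split) (≋-trans (subst-+ (one []) (mgf m) S) (⊕-cong (subst-one S) ≋-refl))
    where
    split : ∀ u → m u ≈ one [] u + mgf m u
    split []      = sym (trans (+-identityʳ _) (sym m₀≈1))
    split (_ ∷ _) = sym (+-identityˡ _)

  infixl 7 _⋆_
  _⋆_ : ZSer → ZSer → ZSer
  (a ⋆ b) v = ∑[ q ∈ splits v ] (a (proj₁ q) * b (proj₂ q))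

  ∂-⋆ : ∀ a b i u → (a ⋆ b) (i ∷ u) ≈ a [] * b (i ∷ u) + (∂ i a ⋆ b) u
  ∂-⋆ a b i u = ∑-splits i u _

  ⊛-[] : ∀ A B v → (A ⊛ B) [] v ≈ (A [] ⋆ B []) v
  ⊛-[] A B v = trans (⊛-expand A B [] v) (+-identityʳ _)

  substN-suc-zvar : ∀ S i N → substN (suc N) (zvar i []) S ≋ S i
  substN-suc-zvar S i N w v = trans (substN-suc N (zvar i []) S w v) (trans (+-cong (zeroˡ _)
    (trans (∑-cong (allFin n) (λ j →
              trans (⊛-congˡ (substN-const N (∂ j (zvar i [])) S (λ _ _ → refl)) w v)
                    (trans (⊛-·ₛ _ (S j) one w v) (*-congˡ (⊛-identityʳ (S j) w v)))))
           (∑-δ i (λ j → S j w v))))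
    (+-identityˡ _))

  module NoConstant (S : Fin n → Ser) (S₀≈0 : NoConst S) where
    prodS-vanish : ∀ u → prodS S u ≈<[ length u ] zeroS
    prodS-vanish []      w v ()
    prodS-vanish (i ∷ u) =
      ≈<-trans (noConst-⊛-cong< (S₀≈0 i) (prodS-vanish u)) (≋⇒≈< (suc (length u)) (⊛-zeroʳ (S i)))

    substN-step : ∀ N g w v → deg w v ≤ N → substN N g S w v ≈ substN (suc N) g S w v
    substN-step N g w v d≤N = sym (trans (∑-wordsUpTo-sucʳ N (λ u → g u * prodS S u w v))
      (trans (+-congˡ (∑-words-zero (suc N) (λ u |u|≡1+N → trans (*-congˡ (prodS-vanish u w v
                (≡.subst (deg w v <_) (≡.sym |u|≡1+N) (s≤s d≤N)))) (zeroʳ _))))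
             (+-identityʳ _)))

    subst≈<substN : ∀ N g → subst g S ≈<[ suc N ] substN N g S
    subst≈<substN N g w v d<1+N =
      ≈-stable (λ k → substN k g S w v) (λ k d≤k → substN-step k g w v d≤k) (≤-pred d<1+N)

    -- Peel off the first letter with substN-suc and the Leibniz rule ∂-⋆.
    substN-⋆ : ∀ N a b → substN N (a ⋆ b) S ≈<[ suc N ] substN N a S ⊛ substN N b S
    substN-⋆ zero a b = ≋⇒≈< 1 (≋-trans (substN-zero (a ⋆ b) S) (≋-trans
      (λ w v → trans (*-congʳ (+-identityʳ _)) (*-assoc _ _ _))
      (≋-sym (≋-trans (⊛-cong (substN-zero a S) (substN-zero b S))
                      (≋-trans (·ₛ-⊛ (a []) one _) (·ₛ-congʳ (a []) (⊛-identityˡ _)))))))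
    substN-⋆ (suc N) a b = ≈<-trans unfold-product (≋⇒≈< _ (≋-trans regroup (≋-sym unfold-factors)))
      where
      a₀ b₀ : K
      a₀ = a []
      b₀ = b []
      Bₙ : Ser
      Bₙ = substN (suc N) b S
      ∂A ∂B : Fin n → Ser
      ∂A i = substN N (∂ i a) S
      ∂B i = substN N (∂ i b) S

      ∂-product : ∀ i → substN N (∂ i (a ⋆ b)) S ≈<[ suc N ] a₀ ·ₛ ∂B i ⊕ ∂A i ⊛ Bₙ
      ∂-product i = ≈<-trans
        (≋⇒≈< _ (≋-trans (substN-cong N S (∂-⋆ a b i))
                         (≋-trans (substN-+ N _ _ S) (⊕-cong (substN-· N a₀ (∂ i b) S) ≋-refl))))
        (⊕-cong< ≈<-refl (≈<-trans (substN-⋆ N (∂ i a) b)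
                                   (⊛-cong< ≈<-refl (λ w v d<1+N → substN-step N b w v (≤-pred d<1+N)))))

      unfold-product : substN (suc N) (a ⋆ b) S ≈<[ suc (suc N) ]
        (a ⋆ b) [] ·ₛ one ⊕ Σₛ (allFin n) (λ i → S i ⊛ (a₀ ·ₛ ∂B i ⊕ ∂A i ⊛ Bₙ))
      unfold-product = ≈<-trans (≋⇒≈< _ (substN-suc N (a ⋆ b) S))
        (⊕-cong< ≈<-refl (Σₛ-cong< (allFin n) (λ i → noConst-⊛-cong< (S₀≈0 i) (∂-product i))))

      regroup : (a ⋆ b) [] ·ₛ one ⊕ Σₛ (allFin n) (λ i → S i ⊛ (a₀ ·ₛ ∂B i ⊕ ∂A i ⊛ Bₙ)) ≋
                a₀ ·ₛ (b₀ ·ₛ one ⊕ Σₛ (allFin n) (λ i → S i ⊛ ∂B i)) ⊕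
                Σₛ (allFin n) (λ i → S i ⊛ (∂A i ⊛ Bₙ))
      regroup w v = trans (+-cong (*-congʳ (+-identityʳ _))
        (trans (∑-cong (allFin n) (λ i →
                  trans (⊛-distribˡ (S i) _ _ w v) (+-congʳ (⊛-·ₛ a₀ (S i) (∂B i) w v))))
               (trans (∑-distrib-+ (allFin n) _ _) (+-congʳ (sym (*-distribˡ-∑ a₀ (allFin n) _))))))
        (factor a₀ b₀ (one w v) _ _)
        where
        factor : ∀ a b o s t → (a * b) * o + (a * s + t) ≈ a * (b * o + s) + t
        factor a b o s t =
          trans (+-congʳ (*-assoc a b o)) (trans (sym (+-assoc _ _ _)) (+-congʳ (sym (distribˡ a _ _))))

      unfold-factors : substN (suc N) a S ⊛ Bₙ ≋
        a₀ ·ₛ (b₀ ·ₛ one ⊕ Σₛ (allFin n) (λ i → S i ⊛ ∂B i)) ⊕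
        Σₛ (allFin n) (λ i → S i ⊛ (∂A i ⊛ Bₙ))
      unfold-factors = ≋-trans (⊛-congʳ (substN-suc N a S)) (≋-trans (⊛-distribʳ Bₙ _ _)
        (⊕-cong (≋-trans (·ₛ-⊛ a₀ one Bₙ) (·ₛ-congʳ a₀ (≋-trans (⊛-identityˡ Bₙ) (substN-suc N b S))))
                (≋-trans (Σₛ-⊛ Bₙ (allFin n) _)
                         (Σₛ-cong (allFin n) (λ i → ⊛-assoc (S i) (∂A i) Bₙ)))))

    subst-⋆ : ∀ a b → subst (a ⋆ b) S ≋ subst a S ⊛ subst b S
    subst-⋆ a b w v = trans (substN-⋆ (deg w v) a b w v ≤-refl)
      (⊛-cong< (≈<-sym (subst≈<substN (deg w v) a)) (≈<-sym (subst≈<substN (deg w v) b)) w v ≤-refl)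

    subst-zvar : ∀ i → subst (zvar i []) S ≋ S i
    subst-zvar i w v = trans (substN-step (deg w v) (zvar i []) w v ≤-refl) (substN-suc-zvar S i (deg w v) w v)

  subst-subst : ∀ {S T} → NoConst S → NoConst T → ∀ g →
                subst (subst g T []) S ≋ subst g (λ i → subst (T i []) S)
  subst-subst {S} {T} S₀≈0 T₀≈0 g w v = begin
    subst (subst g T []) S w v
      ≈⟨ substN-cong-≤ N S (λ v′ |v′|≤N → NT.subst≈<substN N g [] v′ (s≤s |v′|≤N)) w v ⟩
    substN N (λ v′ → ∑[ u ∈ wordsUpTo N ] (g u * prodS T u [] v′)) S w v
      ≈⟨ substN-∑ N (wordsUpTo N) (λ u v′ → g u * prodS T u [] v′) S w v ⟩
    ∑[ u ∈ wordsUpTo N ] substN N (λ v′ → g u * prodS T u [] v′) S w v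
      ≈⟨ ∑-cong (wordsUpTo N) (λ u → substN-· N (g u) (prodS T u []) S w v) ⟩
    ∑[ u ∈ wordsUpTo N ] (g u * substN N (prodS T u []) S w v)
      ≈⟨ ∑-cong (wordsUpTo N) (λ u → *-congˡ (trans (sym (NS.subst≈<substN N (prodS T u []) w v ≤-refl))
                                                    (subst-prodS u w v))) ⟩
    subst g (λ i → subst (T i []) S) w v ∎
    where
    open ≈-Reasoning
    module NS = NoConstant S S₀≈0
    module NT = NoConstant T T₀≈0
    N : ℕ
    N = deg w v

    subst-prodS : ∀ u → subst (prodS T u []) S ≋ prodS (λ i → subst (T i []) S) u
    subst-prodS []      = subst-one S
    subst-prodS (i ∷ u) = ≋-trans (subst-cong S (⊛-[] (T i) (prodS T u)))
      (≋-trans (NS.subst-⋆ (T i []) (prodS T u [])) (⊛-congˡ (subst-prodS u)))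

  XFree : Ser → Set ℓ
  XFree A = ∀ a w v → A (a ∷ w) v ≈ 0#

  ⊛-xfree : ∀ {A B} → XFree A → XFree B → XFree (A ⊛ B)
  ⊛-xfree {A} {B} A-xfree B-xfree a w v = trans (⊛-expand A B (a ∷ w) v) (trans (∑-splits a w _)
    (trans (+-cong (∑-zero (splits v) (λ q → trans (*-congˡ (B-xfree a w _)) (zeroʳ _)))
                   (∑-zero (splits w) (λ p → ∑-zero (splits v) (λ q →
                      trans (*-congʳ (A-xfree a _ _)) (zeroˡ _)))))
           (+-identityˡ 0#)))

  prodS-xfree : ∀ {S} → (∀ i → XFree (S i)) → ∀ u → XFree (prodS S u)
  prodS-xfree S-xfree []      a w v = refl
  prodS-xfree S-xfree (i ∷ u)       = ⊛-xfree (S-xfree i) (prodS-xfree S-xfree u)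

  subst-xfree : ∀ g {S} → (∀ i → XFree (S i)) → XFree (subst g S)
  subst-xfree g S-xfree a w v =
    ∑-zero (wordsUpTo (deg (a ∷ w) v)) (λ u → trans (*-congˡ (prodS-xfree S-xfree u a w v)) (zeroʳ _))

  emb-xfree : ∀ f → XFree (emb f)
  emb-xfree f a w v = refl

  emb-⊛ : ∀ f B w v → (emb f ⊛ B) w v ≈ ∑[ q ∈ splits v ] (f (proj₁ q) * B w (proj₂ q))
  emb-⊛ f B []      v = trans (⊛-expand (emb f) B [] v) (+-identityʳ _)
  emb-⊛ f B (a ∷ w) v = trans (⊛-expand (emb f) B (a ∷ w) v) (trans (∑-splits a w _)
    (trans (+-congˡ (∑-zero (splits w) (λ p → ∑-zero (splits v) (λ q → zeroˡ _)))) (+-identityʳ _)))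

  xdot-⊛ : ∀ S B → xdot S ⊛ B ≋ xdot (λ i → S i ⊛ B)
  xdot-⊛ S B []      v = trans (⊛-expand (xdot S) B [] v)
    (trans (+-identityʳ _) (∑-zero (splits v) (λ q → zeroˡ _)))
  xdot-⊛ S B (i ∷ w) v = trans (⊛-expand (xdot S) B (i ∷ w) v) (trans (∑-splits i w _)
    (trans (+-congʳ (∑-zero (splits v) (λ q → zeroˡ _)))
           (trans (+-identityˡ _) (sym (⊛-expand (S i) B w v)))))

  one⊖xdot₀≈1 : ∀ S → (one ⊖ xdot S) [] [] ≈ 1#
  one⊖xdot₀≈1 S = trans (+-congˡ -0#≈0#) (+-identityʳ _)

  one⊖xdot-⊛ : ∀ S {P Q} → P ≋ one ⊕ Q →
               (one ⊖ xdot (λ i → S i ⊛ P)) ⊕ Q ≋ (one ⊖ xdot S) ⊛ P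
  one⊖xdot-⊛ S {P} {Q} P≋1+Q = begin
    (one ⊖ xdot (λ i → S i ⊛ P)) ⊕ Q ≈⟨ (λ w v → trans (+-congʳ (P≋1+Q w v)) (swap _ _ _)) ⟨
    P ⊖ xdot (λ i → S i ⊛ P)         ≈⟨ ⊖-cong (⊛-identityˡ P) (xdot-⊛ S P) ⟨
    one ⊛ P ⊖ xdot S ⊛ P             ≈⟨ ⊛-distribʳ-⊖ P one (xdot S) ⟨
    (one ⊖ xdot S) ⊛ P               ∎
    where
    open ≋-Reasoning
    swap : ∀ o q x → (o + q) - x ≈ (o - x) + q
    swap = solve 3 (λ o q x → ((o :+ q) :+ :- x) ⊜ ((o :+ :- x) :+ q)) refl

  -- Sheffer series and the moment functional

  monomials : (Fin n → ZSer) → Ser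
  monomials V w v = prodS (λ i → emb (V i)) w [] v

  one⊖xdot-⊛-monomials : ∀ V → (one ⊖ xdot (λ i → emb (V i))) ⊛ monomials V ≋ one
  one⊖xdot-⊛-monomials V =
    ≋-trans (⊛-distribʳ-⊖ G one X) (≋-trans (⊖-cong (⊛-identityˡ G) (xdot-⊛ Vs G)) recursion)
    where
    Vs : Fin n → Ser
    Vs i = emb (V i)
    X G : Ser
    X = xdot Vs
    G = monomials V

    recursion : G ⊖ xdot (λ i → Vs i ⊛ G) ≋ one
    recursion []      v = trans (+-congˡ -0#≈0#) (+-identityʳ _)
    recursion (i ∷ w) v =
      trans (+-cong (emb-⊛ (V i) (prodS Vs w) [] v) (-‿cong (emb-⊛ (V i) G w v))) (-‿inverseʳ _)

  inv-one⊖xdot : ∀ V → inv (one ⊖ xdot (λ i → emb (V i))) ≋ monomials V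
  inv-one⊖xdot V = inv-unique (one⊖xdot₀≈1 (λ i → emb (V i))) (one⊖xdot-⊛-monomials V)

  sheffer : ZSer → (Fin n → ZSer) → Ser
  sheffer F V = emb F ⊛ inv (one ⊖ xdot (λ i → emb (V i)))

  -- The right-hand side is φ[P_v]: φ applied to the coefficient of z_v in H.
  emb-⊛-subst-moments : ∀ F V m → NoConst (λ i → emb (V i)) → ∀ v →
    (emb F ⊛ subst m (λ i → emb (V i))) [] v ≈ ∑[ w ∈ wordsUpTo (length v) ] (sheffer F V w v * m w)
  emb-⊛-subst-moments F V m V₀≈0 v = begin
    (emb F ⊛ subst m Vs) [] v
      ≈⟨ emb-⊛ F (subst m Vs) [] v ⟩
    ∑[ q ∈ splits v ] (F (proj₁ q) * subst m Vs [] (proj₂ q))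
      ≈⟨ ∑-splits-cong v (λ v₁ v₂ eq →
           *-congˡ (subst≈<substN N m [] v₂ (s≤s (++-length-≤ʳ v₁ v₂ eq)))) ⟩
    ∑[ q ∈ splits v ] (F (proj₁ q) * ∑[ w ∈ W ] (m w * monomials V w (proj₂ q)))
      ≈⟨ ∑-cong (splits v) (λ q → *-distribˡ-∑ _ W _) ⟩
    ∑[ q ∈ splits v ] ∑[ w ∈ W ] (F (proj₁ q) * (m w * monomials V w (proj₂ q)))
      ≈⟨ ∑-comm (splits v) W _ ⟩
    ∑[ w ∈ W ] ∑[ q ∈ splits v ] (F (proj₁ q) * (m w * monomials V w (proj₂ q)))
      ≈⟨ ∑-cong W (λ w → trans (∑-cong (splits v) (λ q → x*[k*y]≈[x*y]*k _ _ _))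
                               (sym (*-distribʳ-∑ (m w) (splits v) _))) ⟩
    ∑[ w ∈ W ] (∑[ q ∈ splits v ] (F (proj₁ q) * monomials V w (proj₂ q)) * m w)
      ≈⟨ ∑-cong W (λ w → *-congʳ (emb-⊛ F (monomials V) w v)) ⟨
    ∑[ w ∈ W ] ((emb F ⊛ monomials V) w v * m w)
      ≈⟨ ∑-cong W (λ w → *-congʳ (⊛-congˡ (inv-one⊖xdot V) w v)) ⟨
    ∑[ w ∈ W ] (sheffer F V w v * m w) ∎
    where
    open ≈-Reasoning
    open NoConstant (λ i → emb (V i)) V₀≈0 using (subst≈<substN)
    Vs : Fin n → Ser
    Vs i = emb (V i)
    N : ℕ
    N = length v
    W : List Word
    W = wordsUpTo N

    x*[k*y]≈[x*y]*k : ∀ x k y → x * (k * y) ≈ (x * y) * k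
    x*[k*y]≈[x*y]*k x k y = trans (*-congˡ (*-comm k y)) (sym (*-assoc x y k))

  inv-emb≋subst-moments : ∀ F V m → F [] ≈ 1# → NoConst (λ i → emb (V i)) → m [] ≈ 1# →
    (∀ i u → ∑[ w ∈ wordsUpTo (length (i ∷ u)) ] (sheffer F V w (i ∷ u) * m w) ≈ 0#) →
    inv (emb F) ≋ subst m (λ i → emb (V i))
  inv-emb≋subst-moments F V m F₀≈1 V₀≈0 m₀≈1 φ[P]≈0 = inv-unique F₀≈1 F⊛P≋1
    where
    Vs : Fin n → Ser
    Vs i = emb (V i)

    P : Ser
    P = subst m Vs

    F⊛P≋1 : emb F ⊛ P ≋ one
    F⊛P≋1 (a ∷ w) v = ⊛-xfree (emb-xfree F) (subst-xfree m (λ i → emb-xfree (V i))) a w v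
    F⊛P≋1 []      [] = trans (emb-⊛ F P [] [])
      (trans (+-identityʳ _) (trans (*-cong F₀≈1 (trans (subst₀ m Vs) m₀≈1)) (*-identityˡ _)))
    F⊛P≋1 [] (i ∷ u) = trans (emb-⊛-subst-moments F V m V₀≈0 (i ∷ u)) (φ[P]≈0 i u)

  zvar-⊛₀≈0 : ∀ i A → (zvar i ⊛ A) [] [] ≈ 0#
  zvar-⊛₀≈0 i A = trans (⊛-[] (zvar i) A []) (trans (+-identityʳ _) (zeroˡ _))

  subst-zvar-⊛ : ∀ {S} → NoConst S → ∀ i A → subst ((zvar i ⊛ A) []) S ≋ S i ⊛ subst (A []) S
  subst-zvar-⊛ {S} S₀≈0 i A =
    ≋-trans (subst-cong S (⊛-[] (zvar i) A))
            (≋-trans (subst-⋆ (zvar i []) (A [])) (⊛-congʳ (subst-zvar i)))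
    where open NoConstant S S₀≈0

  subst-cumulants : ∀ {S} → NoConst S → ∀ m Rc → m [] ≈ 1# →
    subst Rc (λ i → zvar i ⊛ (one ⊕ emb (mgf m))) ≋ emb (mgf m) →
    subst Rc (λ i → S i ⊛ subst m S) ≋ subst (mgf m) S
  subst-cumulants {S} S₀≈0 m Rc m₀≈1 R[T]≋M = begin
    subst Rc (λ i → S i ⊛ subst m S)
      ≈⟨ subst-congʳ Rc (λ i → ⊛-congˡ (subst-cong S 1+M≈m)) ⟨
    subst Rc (λ i → S i ⊛ subst (T₁ []) S)
      ≈⟨ subst-congʳ Rc (λ i → subst-zvar-⊛ S₀≈0 i T₁) ⟨
    subst Rc (λ i → subst (T i []) S)
      ≈⟨ subst-subst S₀≈0 (λ i → zvar-⊛₀≈0 i T₁) Rc ⟨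
    subst (subst Rc T []) S
      ≈⟨ subst-cong S (R[T]≋M []) ⟩
    subst (mgf m) S ∎
    where
    open ≋-Reasoning
    T₁ : Ser
    T₁ = one ⊕ emb (mgf m)
    T : Fin n → Ser
    T i = zvar i ⊛ T₁

    1+M≈m : ∀ u → T₁ [] u ≈ m u
    1+M≈m []      = trans (+-identityʳ _) (sym m₀≈1)
    1+M≈m (_ ∷ _) = +-identityˡ _

lemma3p4 : ∀ {c ℓ} (Rg : CommutativeRing c ℓ) (n : ℕ) →
  let open CommutativeRing Rg
      open Series Rg n
  in (F : ZSer) (V : Fin n → ZSer) →
     F [] ≈ 1# →
     (∀ i → F (i ∷ []) ≈ 0#) →
     (∀ i j → F (i ∷ j ∷ []) ≈ - δ i j) →
     (∀ i → V i [] ≈ 0#) →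
     (∀ i j → V i (j ∷ []) ≈ δ i j) →
     let H = emb F ⊛ inv (one ⊖ xdot (λ i → emb (V i)))
     in (m : Word → Carrier) →
        m [] ≈ 1# →
        (∀ i u → Σl (map (λ w → H w (i ∷ u) * m w) (wordsUpTo (length (i ∷ u)))) ≈ 0#) →
        (Rc : ZSer) →
        Rc [] ≈ 0# →
        subst Rc (λ i → zvar i ⊛ (one ⊕ emb (mgf m))) ≋ emb (mgf m) →
        let U = λ i → emb (V i) ⊛ inv (emb F)
        in H ≋ inv (one ⊖ xdot U ⊕ subst Rc U)
lemma3p4 Rg n F V F₀≈1 _ _ V₀≈0 _ m m₀≈1 φ[P]≈0 Rc Rc₀≈0 R[z[1+M]]≋M =
  inv-uniqueˡ B₀≈1 (begin
    (E ⊛ inv (one ⊖ X)) ⊛ B                   ≈⟨ ⊛-congˡ B≋[1-X]E⁻¹ ⟩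
    (E ⊛ inv (one ⊖ X)) ⊛ ((one ⊖ X) ⊛ inv E) ≈⟨ ⊛-cancel-inner E _ _ (inv E) (inv-inverseˡ (one⊖xdot₀≈1 Vs)) ⟩
    E ⊛ inv E                                 ≈⟨ inv-inverseʳ F₀≈1 ⟩
    one                                       ∎)
  where
  open CommutativeRing Rg
  open Series Rg n
  open SeriesProperties Rg n
  open ≋-Reasoning

  Vs U : Fin n → Ser
  Vs i = emb (V i)
  U i = Vs i ⊛ inv (emb F)

  E X B : Ser
  E = emb F
  X = xdot Vs
  B = one ⊖ xdot U ⊕ subst Rc U

  E⁻¹≋m[V] : inv E ≋ subst m Vs
  E⁻¹≋m[V] = inv-emb≋subst-moments F V m F₀≈1 V₀≈0 m₀≈1 φ[P]≈0

  R[U]≋M[V] : subst Rc U ≋ subst (mgf m) Vs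
  R[U]≋M[V] =
    ≋-trans (subst-congʳ Rc (λ i → ⊛-congˡ E⁻¹≋m[V])) (subst-cumulants V₀≈0 m Rc m₀≈1 R[z[1+M]]≋M)

  B≋[1-X]E⁻¹ : B ≋ (one ⊖ X) ⊛ inv E
  B≋[1-X]E⁻¹ =
    one⊖xdot-⊛ Vs (≋-trans E⁻¹≋m[V] (≋-trans (subst-mgf Vs m₀≈1) (⊕-cong ≋-refl (≋-sym R[U]≋M[V]))))

  B₀≈1 : B [] [] ≈ 1#
  B₀≈1 = trans (+-cong (one⊖xdot₀≈1 U) (trans (subst₀ Rc U) Rc₀≈0)) (+-identityʳ 1#)
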